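{- For every integer $k\geq 1$, let $$P_k(x,q)=\sum_{n\geq k}\sum_{\pi\in P_{n,k}}x^nq^{\mathrm{swrec}(\pi)}$$ (as a formal power series in $x$ with coefficients polynomials in $q$). Then $$P_k(x,q)=\prod_{i=1}^{k}\frac{x\,q^i\,q^{(k+1-i)(k-i)}}{1-ix\prod_{j=i+1}^{k}q^j}.$$
   Context: A partition of $[n]=\{1,\dots,n\}$ into exactly $k$ blocks is a collection $\{B_1,\dots,B_k\}$ of nonempty, pairwise disjoint subsets with union $[n]$, with blocks listed so that $\min B_1<\min B_2<\cdots<\min B_k$. Its canonical sequential form is the word $\pi=\pi_1\pi_2\cdots\pi_n$ where $i\in B_{\pi_i}$. $P_{n,k}$ denotes the set of partitions of $[n]$ with exactly $k$ blocks, identified with their canonical sequential forms. In a word $\pi=\pi_1\cdots\pi_n$, the entry $\pi_i$ is a record (at position $i$) if $\pi_i>\pi_j$ for all $j<i$. The statistic $\mathrm{swrec}(\pi)$ is the sum, over all records $\pi_i$ of $\pi$, of $i\cdot\pi_i$ (position times value); e.g. $\mathrm{swrec}(121132)=1\cdot1+2\cdot2+3\cdot5=20$. -}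

module Defs where

open import Data.Nat using (ℕ; zero; suc; _+_; _*_; _∸_; _^_; _≤ᵇ_; _<ᵇ_; _≡ᵇ_; _⊔_)
open import Data.Bool using (Bool; true; false; _∧_; if_then_else_)
open import Data.List using (List; []; _∷_; map; concatMap; length; filterᵇ; upTo; foldr)
open import Data.Nat.ListAction using (sum)

-- Set partitions of [n] with exactly k blocks, via canonical sequential
-- forms (restricted growth words): π_1 … π_n with values in {1,…,k},
-- π_i ≤ 1 + max(π_1,…,π_{i-1}), and max π = k.

words : ℕ → ℕ → List (List ℕ)
words zero    k = [] ∷ []
words (suc n) k = concatMap (λ w → map (λ v → suc v ∷ w) (upTo k)) (words n k)

rgfFrom : ℕ → List ℕ → Bool
rgfFrom mx []       = true
rgfFrom mx (x ∷ xs) = (1 ≤ᵇ x) ∧ (x ≤ᵇ suc mx) ∧ rgfFrom (mx ⊔ x) xs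

maxW : List ℕ → ℕ
maxW = foldr _⊔_ 0

isCanonical : ℕ → List ℕ → Bool
isCanonical k π = rgfFrom 0 π ∧ (maxW π ≡ᵇ k)

P : ℕ → ℕ → List (List ℕ)
P n k = filterᵇ (isCanonical k) (words n k)

-- swrec: sum of position × value over records (positions start at 1)
swrecFrom : ℕ → ℕ → List ℕ → ℕ
swrecFrom pos mx []       = 0
swrecFrom pos mx (x ∷ xs) =
  (if mx <ᵇ x then pos * x else 0) + swrecFrom (suc pos) (mx ⊔ x) xs

swrec : List ℕ → ℕ
swrec π = swrecFrom 1 0 π

-- Formal power series in x,q with ℕ coefficients:
-- f n m = coefficient of x^n q^m.

Series : Set
Series = ℕ → ℕ → ℕ

sumTo : ℕ → (ℕ → ℕ) → ℕ
sumTo zero    f = f 0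
sumTo (suc n) f = sumTo n f + f (suc n)

_⊛_ : Series → Series → Series
(f ⊛ g) n m = sumTo n (λ a → sumTo m (λ b → f a b * g (n ∸ a) (m ∸ b)))

one : Series
one zero    zero    = 1
one _       _       = 0

mono : ℕ → ℕ → ℕ → Series
mono c a b n m = if (n ≡ᵇ a) ∧ (m ≡ᵇ b) then c else 0

pow : Series → ℕ → Series
pow u zero    = one
pow u (suc a) = u ⊛ pow u a

-- 1/(1 - u) = Σ_{a≥0} u^a, for u without x-free terms (only such u are
-- used below); the x^n-coefficient only receives contributions from a ≤ n.
geom : Series → Series
geom u n m = sumTo n (λ a → pow u a n m)

prodTo : ℕ → (ℕ → Series) → Series
prodTo zero    F = one
prodTo (suc k) F = prodTo k F ⊛ F (suc k)

-- Σ_{j=i+1}^{k} j  (exponent of ∏_{j=i+1}^{k} q^j)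
sumFrom : ℕ → ℕ → ℕ
sumFrom i k = sum (map (λ t → suc i + t) (upTo (k ∸ i)))

-- Left side: P_k(x,q) = Σ_{n≥k} Σ_{π∈P_{n,k}} x^n q^{swrec π}
-- (for n < k the set P_{n,k} is empty, so summing over all n is the same)
Pk : ℕ → Series
Pk k n m = length (filterᵇ (λ π → swrec π ≡ᵇ m) (P n k))

factor : ℕ → ℕ → Series
factor k i = mono 1 1 (i + (suc k ∸ i) * (k ∸ i)) ⊛ geom (mono i 1 (sumFrom i k))

RHS : ℕ → Series
RHS k = prodTo k (factor k)

module Submission where

-- Both sides satisfy the same recurrence in (k, n), with the same boundary values.  Deleting the
-- last letter of a canonical word with k+1 blocks and n+1 letters gives
--   P_{n+1,k+1}(q) = (k+1) P_{n,k+1}(q) + q^{(n+1)(k+1)} P_{n,k}(q),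
-- the second term counting the words whose last letter is the new record k+1.  In the product
-- for k+1, the last factor x q^{k+1} / (1 − (k+1) x) accounts for the factor k+1 and the shift
-- q^{k+1}, while the first k factors multiply out to the product for k evaluated at x q^{k+1}.

open import Defs
open import Data.Nat using (ℕ; zero; suc; _+_; _*_; _∸_; _^_; _≤ᵇ_; _<ᵇ_; _≡ᵇ_; _⊔_; _≤_; _<_; z≤n; s≤s)
open import Data.Nat.Properties
open import Data.Nat.ListAction using (sum)
open import Data.Nat.Solver using (module +-*-Solver)
open import Data.Bool using (Bool; true; false; _∧_; if_then_else_)
open import Data.Bool.Properties using (∧-assoc; ∧-identityʳ; ∧-zeroʳ; if-eta; if-float; if-cong; if-cong-then; if-cong-else)
open import Data.List using (List; []; _∷_; _++_; _∷ʳ_; map; concatMap; length; filterᵇ; applyUpTo)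
open import Data.Sum using (inj₁; inj₂)
open import Function using (_∘_; id)
open import Level using (0ℓ)
open import Relation.Binary using (Setoid; tri<; tri≈; tri>)
import Relation.Binary.Reasoning.Setoid as SetoidReasoning
open import Relation.Nullary using (¬_; yes; no)
open import Relation.Nullary.Decidable using (dec-true; dec-false)
open import Relation.Binary.PropositionalEquality
open import Algebra.Properties.CommutativeSemigroup +-commutativeSemigroup using () renaming (interchange to +-interchange)

private
  variable
    A B : Set

≤⇒≤ᵇ≡true : ∀ {m n} → m ≤ n → (m ≤ᵇ n) ≡ true
≤⇒≤ᵇ≡true = dec-true (_ ≤? _)

≰⇒≤ᵇ≡false : ∀ {m n} → ¬ m ≤ n → (m ≤ᵇ n) ≡ false
≰⇒≤ᵇ≡false = dec-false (_ ≤? _)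

≮⇒<ᵇ≡false : ∀ {m n} → ¬ m < n → (m <ᵇ n) ≡ false
≮⇒<ᵇ≡false = dec-false (_ <? _)

≡⇒≡ᵇ≡true : ∀ {m n} → m ≡ n → (m ≡ᵇ n) ≡ true
≡⇒≡ᵇ≡true = dec-true (_ ≟ _)

≢⇒≡ᵇ≡false : ∀ {m n} → m ≢ n → (m ≡ᵇ n) ≡ false
≢⇒≡ᵇ≡false = dec-false (_ ≟ _)

indicator : Bool → ℕ
indicator b = if b then 1 else 0

indicator-+ : ∀ s c m → indicator (s + c ≡ᵇ m) ≡ (if c ≤ᵇ m then indicator (s ≡ᵇ m ∸ c) else 0)
indicator-+ s c m with c ≤? m
... | no c≰m
  rewrite ≰⇒≤ᵇ≡false c≰m
        | ≢⇒≡ᵇ≡false {s + c} {m} (λ s+c≡m → c≰m (subst (c ≤_) s+c≡m (m≤n+m c s))) = refl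
... | yes c≤m rewrite ≤⇒≤ᵇ≡true c≤m with s ≟ m ∸ c
...   | yes s≡m∸c
  rewrite ≡⇒≡ᵇ≡true s≡m∸c
        | ≡⇒≡ᵇ≡true {s + c} {m} (trans (cong (_+ c) s≡m∸c) (m∸n+n≡m c≤m)) = refl
...   | no s≢m∸c
  rewrite ≢⇒≡ᵇ≡false s≢m∸c
        | ≢⇒≡ᵇ≡false {s + c} {m} (λ s+c≡m → s≢m∸c (trans (sym (m+n∸n≡m s c)) (cong (_∸ c) s+c≡m))) = refl

-- Finite sums

sumBelow : ℕ → (ℕ → ℕ) → ℕ
sumBelow zero    f = 0
sumBelow (suc k) f = f 0 + sumBelow k (f ∘ suc)

sumBelow-cong : ∀ k {f g : ℕ → ℕ} → (∀ v → v < k → f v ≡ g v) → sumBelow k f ≡ sumBelow k g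
sumBelow-cong zero    eq = refl
sumBelow-cong (suc k) eq = cong₂ _+_ (eq 0 (s≤s z≤n)) (sumBelow-cong k (λ v v<k → eq (suc v) (s≤s v<k)))

sumBelow-zero : ∀ k {f : ℕ → ℕ} → (∀ v → v < k → f v ≡ 0) → sumBelow k f ≡ 0
sumBelow-zero zero    eq = refl
sumBelow-zero (suc k) eq = cong₂ _+_ (eq 0 (s≤s z≤n)) (sumBelow-zero k (λ v v<k → eq (suc v) (s≤s v<k)))

sumBelow-last : ∀ k (f : ℕ → ℕ) → sumBelow (suc k) f ≡ sumBelow k f + f k
sumBelow-last zero    f = +-identityʳ (f 0)
sumBelow-last (suc k) f = trans (cong (f 0 +_) (sumBelow-last k (f ∘ suc))) (sym (+-assoc (f 0) _ _))

sumBelow-const : ∀ k c → sumBelow k (λ _ → c) ≡ k * c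
sumBelow-const zero    c = refl
sumBelow-const (suc k) c = cong (c +_) (sumBelow-const k c)

sumBelow-+ : ∀ k (f g : ℕ → ℕ) → sumBelow k (λ v → f v + g v) ≡ sumBelow k f + sumBelow k g
sumBelow-+ zero    f g = refl
sumBelow-+ (suc k) f g =
  trans (cong (f 0 + g 0 +_) (sumBelow-+ k (f ∘ suc) (g ∘ suc))) (+-interchange (f 0) (g 0) _ _)

sumBelow-comm : ∀ j k (g : ℕ → ℕ → ℕ) →
  sumBelow j (λ u → sumBelow k (g u)) ≡ sumBelow k (λ v → sumBelow j (λ u → g u v))
sumBelow-comm zero    k g = sym (sumBelow-zero k (λ _ _ → refl))
sumBelow-comm (suc j) k g =
  trans (cong (sumBelow k (g 0) +_) (sumBelow-comm j k (g ∘ suc))) (sym (sumBelow-+ k (g 0) _))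

sumMap : (A → ℕ) → List A → ℕ
sumMap f []       = 0
sumMap f (x ∷ xs) = f x + sumMap f xs

sumMap-cong : ∀ (xs : List A) {f g : A → ℕ} → (∀ x → f x ≡ g x) → sumMap f xs ≡ sumMap g xs
sumMap-cong []       eq = refl
sumMap-cong (x ∷ xs) eq = cong₂ _+_ (eq x) (sumMap-cong xs eq)

sumMap-++ : ∀ (f : A → ℕ) xs ys → sumMap f (xs ++ ys) ≡ sumMap f xs + sumMap f ys
sumMap-++ f []       ys = refl
sumMap-++ f (x ∷ xs) ys = trans (cong (f x +_) (sumMap-++ f xs ys)) (sym (+-assoc (f x) _ _))

sumMap-concatMap : ∀ (f : B → ℕ) (g : A → List B) xs → sumMap f (concatMap g xs) ≡ sumMap (sumMap f ∘ g) xs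
sumMap-concatMap f g []       = refl
sumMap-concatMap f g (x ∷ xs) =
  trans (sumMap-++ f (g x) (concatMap g xs)) (cong (sumMap f (g x) +_) (sumMap-concatMap f g xs))

sumMap-map : ∀ (f : B → ℕ) (g : A → B) xs → sumMap f (map g xs) ≡ sumMap (f ∘ g) xs
sumMap-map f g []       = refl
sumMap-map f g (x ∷ xs) = cong (f (g x) +_) (sumMap-map f g xs)

sumMap-applyUpTo : ∀ (f : A → ℕ) (g : ℕ → A) k → sumMap f (applyUpTo g k) ≡ sumBelow k (f ∘ g)
sumMap-applyUpTo f g zero    = refl
sumMap-applyUpTo f g (suc k) = cong (f (g 0) +_) (sumMap-applyUpTo f (g ∘ suc) k)

sumMap-zero : ∀ (xs : List A) → sumMap (λ _ → 0) xs ≡ 0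
sumMap-zero []       = refl
sumMap-zero (x ∷ xs) = sumMap-zero xs

sumMap-+ : ∀ (xs : List A) (f g : A → ℕ) → sumMap (λ x → f x + g x) xs ≡ sumMap f xs + sumMap g xs
sumMap-+ []       f g = refl
sumMap-+ (x ∷ xs) f g = trans (cong (f x + g x +_) (sumMap-+ xs f g)) (+-interchange (f x) (g x) _ _)

sumMap-* : ∀ (xs : List A) c (f : A → ℕ) → sumMap (λ x → c * f x) xs ≡ c * sumMap f xs
sumMap-* []       c f = sym (*-zeroʳ c)
sumMap-* (x ∷ xs) c f = trans (cong (c * f x +_) (sumMap-* xs c f)) (sym (*-distribˡ-+ c (f x) _))

sumMap-if : ∀ (xs : List A) b (f : A → ℕ) → sumMap (λ x → if b then f x else 0) xs ≡ (if b then sumMap f xs else 0)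
sumMap-if xs       true  f = refl
sumMap-if []       false f = refl
sumMap-if (x ∷ xs) false f = sumMap-if xs false f

length-filterᵇ-filterᵇ : ∀ (p q : A → Bool) xs →
  length (filterᵇ q (filterᵇ p xs)) ≡ sumMap (λ x → if p x then indicator (q x) else 0) xs
length-filterᵇ-filterᵇ p q [] = refl
length-filterᵇ-filterᵇ p q (x ∷ xs) with p x
... | false = length-filterᵇ-filterᵇ p q xs
... | true with q x
...   | true  = cong suc (length-filterᵇ-filterᵇ p q xs)
...   | false = length-filterᵇ-filterᵇ p q xs

-- Canonical sequential forms

sumMap-words-suc : ∀ n k (f : List ℕ → ℕ) →
  sumMap f (words (suc n) k) ≡ sumMap (λ w → sumBelow k (λ v → f (suc v ∷ w))) (words n k)
sumMap-words-suc n k f =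
  trans (sumMap-concatMap f _ (words n k))
        (sumMap-cong (words n k) (λ w →
          trans (sumMap-map f (λ v → suc v ∷ w) (applyUpTo id k))
                (sumMap-applyUpTo _ id k)))

sumMap-words-∷ʳ : ∀ n k (f : List ℕ → ℕ) →
  sumMap f (words (suc n) k) ≡ sumMap (λ w → sumBelow k (λ v → f (w ∷ʳ suc v))) (words n k)
sumMap-words-∷ʳ zero    k f = sumMap-words-suc zero k f
sumMap-words-∷ʳ (suc n) k f = begin
  sumMap f (words (suc (suc n)) k)
    ≡⟨ sumMap-words-suc (suc n) k f ⟩
  sumMap (λ w → sumBelow k (λ v → f (suc v ∷ w))) (words (suc n) k)
    ≡⟨ sumMap-words-∷ʳ n k _ ⟩
  sumMap (λ w → sumBelow k (λ u → sumBelow k (λ v → f (suc v ∷ w ∷ʳ suc u)))) (words n k)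
    ≡⟨ sumMap-cong (words n k) (λ w → sumBelow-comm k k (λ u v → f (suc v ∷ w ∷ʳ suc u))) ⟩
  sumMap (λ w → sumBelow k (λ v → sumBelow k (λ u → f (suc v ∷ w ∷ʳ suc u)))) (words n k)
    ≡⟨ sym (sumMap-words-suc n k _) ⟩
  sumMap (λ w → sumBelow k (λ u → f (w ∷ʳ suc u))) (words (suc n) k)
    ∎
  where open ≡-Reasoning

sumMap-words-cong : ∀ n k {f g : List ℕ → ℕ} →
  (∀ w → length w ≡ n → maxW w ≤ k → f w ≡ g w) → sumMap f (words n k) ≡ sumMap g (words n k)
sumMap-words-cong zero    k eq = cong (_+ 0) (eq [] refl z≤n)
sumMap-words-cong (suc n) k {f} {g} eq =
  trans (sumMap-words-suc n k f)
    (trans (sumMap-words-cong n k (λ w len-w max-w → sumBelow-cong k (λ v v<k →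
              eq (suc v ∷ w) (cong suc len-w) (⊔-lub v<k max-w))))
      (sym (sumMap-words-suc n k g)))

sumMap-words-shrink : ∀ n j (f : List ℕ → ℕ) → (∀ w → j < maxW w → f w ≡ 0) →
  sumMap f (words n (suc j)) ≡ sumMap f (words n j)
sumMap-words-shrink zero    j f vanish = refl
sumMap-words-shrink (suc n) j f vanish = begin
  sumMap f (words (suc n) (suc j))
    ≡⟨ sumMap-words-suc n (suc j) f ⟩
  sumMap (λ w → sumBelow (suc j) (λ v → f (suc v ∷ w))) (words n (suc j))
    ≡⟨ sumMap-cong (words n (suc j)) dropLast ⟩
  sumMap (λ w → sumBelow j (λ v → f (suc v ∷ w))) (words n (suc j))
    ≡⟨ sumMap-words-shrink n j _ (λ w j<w → sumBelow-zero j (λ v _ →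
         vanish (suc v ∷ w) (<-≤-trans j<w (m≤n⊔m (suc v) (maxW w))))) ⟩
  sumMap (λ w → sumBelow j (λ v → f (suc v ∷ w))) (words n j)
    ≡⟨ sym (sumMap-words-suc n j f) ⟩
  sumMap f (words (suc n) j)
    ∎
  where
  open ≡-Reasoning
  dropLast : ∀ w → sumBelow (suc j) (λ v → f (suc v ∷ w)) ≡ sumBelow j (λ v → f (suc v ∷ w))
  dropLast w = trans (sumBelow-last j (λ v → f (suc v ∷ w)))
    (trans (cong (sumBelow j (λ v → f (suc v ∷ w)) +_) (vanish (suc j ∷ w) (m≤m⊔n (suc j) (maxW w)))) (+-identityʳ _))

rgfFrom-∷ʳ : ∀ mx w u → rgfFrom mx (w ∷ʳ u) ≡ rgfFrom mx w ∧ ((1 ≤ᵇ u) ∧ (u ≤ᵇ suc (mx ⊔ maxW w)))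
rgfFrom-∷ʳ mx [] u rewrite ⊔-identityʳ mx = cong ((1 ≤ᵇ u) ∧_) (∧-identityʳ (u ≤ᵇ suc mx))
rgfFrom-∷ʳ mx (x ∷ w) u rewrite rgfFrom-∷ʳ (mx ⊔ x) w u | ⊔-assoc mx x (maxW w) =
  trans (cong ((1 ≤ᵇ x) ∧_) (sym (∧-assoc (x ≤ᵇ suc mx) (rgfFrom (mx ⊔ x) w) _)))
        (sym (∧-assoc (1 ≤ᵇ x) _ _))

maxW-∷ʳ : ∀ w u → maxW (w ∷ʳ u) ≡ maxW w ⊔ u
maxW-∷ʳ []      u = ⊔-identityʳ u
maxW-∷ʳ (x ∷ w) u = trans (cong (x ⊔_) (maxW-∷ʳ w u)) (sym (⊔-assoc x (maxW w) u))

swrecFrom-∷ʳ : ∀ pos mx w u → swrecFrom pos mx (w ∷ʳ u) ≡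
  swrecFrom pos mx w + (if (mx ⊔ maxW w) <ᵇ u then (pos + length w) * u else 0)
swrecFrom-∷ʳ pos mx [] u rewrite ⊔-identityʳ mx | +-identityʳ pos = +-identityʳ _
swrecFrom-∷ʳ pos mx (x ∷ w) u
  rewrite swrecFrom-∷ʳ (suc pos) (mx ⊔ x) w u | ⊔-assoc mx x (maxW w) | +-suc pos (length w) =
  sym (+-assoc (if mx <ᵇ x then pos * x else 0) _ _)

-- χ k m π depends on π only through its restricted-growth flag, its maximum and its swrec.
weight : Bool → (M s k m : ℕ) → ℕ
weight r M s k m = if r ∧ (M ≡ᵇ k) then indicator (s ≡ᵇ m) else 0

χ : ℕ → ℕ → List ℕ → ℕ
χ k m π = weight (rgfFrom 0 π) (maxW π) (swrec π) k m

Pk≡sumMap-χ : ∀ k n m → Pk k n m ≡ sumMap (χ k m) (words n k)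
Pk≡sumMap-χ k n m = length-filterᵇ-filterᵇ (isCanonical k) (λ π → swrec π ≡ᵇ m) (words n k)

weight-≢ : ∀ r {M k} s m → M ≢ k → weight r M s k m ≡ 0
weight-≢ r s m M≢k rewrite ≢⇒≡ᵇ≡false M≢k | ∧-zeroʳ r = refl

weight-≡ : ∀ k s m → weight true k s k m ≡ indicator (s ≡ᵇ m)
weight-≡ k s m rewrite ≡⇒≡ᵇ≡true {k} refl = refl

weight∷ʳ : Bool → (M s n u k m : ℕ) → ℕ
weight∷ʳ r M s n u = weight (r ∧ (u ≤ᵇ suc M)) (M ⊔ u) (s + (if M <ᵇ u then suc n * u else 0))

χ-∷ʳ : ∀ k m w v → χ k m (w ∷ʳ suc v) ≡ weight∷ʳ (rgfFrom 0 w) (maxW w) (swrec w) (length w) (suc v) k m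
χ-∷ʳ k m w v rewrite rgfFrom-∷ʳ 0 w (suc v) | maxW-∷ʳ w (suc v) | swrecFrom-∷ʳ 1 0 w (suc v) = refl

weight∷ʳ-≤ : ∀ {u M} s n k m → u ≤ M → weight∷ʳ true M s n u k m ≡ weight true M s k m
weight∷ʳ-≤ {u} {M} s n k m u≤M
  rewrite ≤⇒≤ᵇ≡true (m≤n⇒m≤1+n u≤M) | m≥n⇒m⊔n≡m u≤M | ≮⇒<ᵇ≡false (≤⇒≯ u≤M) | +-identityʳ s = refl

weight∷ʳ-record : ∀ M s n k m → weight∷ʳ true M s n (suc M) k m ≡ weight true (suc M) (s + suc n * suc M) k m
weight∷ʳ-record M s n k m
  rewrite ≤⇒≤ᵇ≡true (≤-refl {suc M}) | m≤n⇒m⊔n≡n (n≤1+n M) = refl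

weight∷ʳ-jump : ∀ {u M} s n k m → suc M < u → weight∷ʳ true M s n u k m ≡ 0
weight∷ʳ-jump s n k m M+1<u rewrite ≰⇒≤ᵇ≡false (<⇒≱ M+1<u) = refl

sumBelow-weight∷ʳ : ∀ r M s n k m → M ≤ suc k →
  sumBelow (suc k) (λ v → weight∷ʳ r M s n (suc v) (suc k) m)
    ≡ suc k * weight r M s (suc k) m
      + (if suc n * suc k ≤ᵇ m then weight r M s k (m ∸ suc n * suc k) else 0)
sumBelow-weight∷ʳ false M s n k m _ =
  trans (sumBelow-zero (suc k) (λ _ _ → refl)) (sym (cong₂ _+_ (*-zeroʳ (suc k)) (if-eta _)))
sumBelow-weight∷ʳ true M s n k m M≤1+k with m≤n⇒m<n∨m≡n M≤1+k
... | inj₂ refl = begin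
  sumBelow (suc k) (λ v → weight∷ʳ true (suc k) s n (suc v) (suc k) m)
    ≡⟨ sumBelow-cong (suc k) (λ v v<1+k → weight∷ʳ-≤ s n (suc k) m v<1+k) ⟩
  sumBelow (suc k) (λ _ → weight true (suc k) s (suc k) m)
    ≡⟨ sumBelow-const (suc k) _ ⟩
  suc k * weight true (suc k) s (suc k) m
    ≡⟨ sym (+-identityʳ _) ⟩
  suc k * weight true (suc k) s (suc k) m + 0
    ≡⟨ cong (suc k * weight true (suc k) s (suc k) m +_)
         (sym (trans (if-cong-then (suc n * suc k ≤ᵇ m) (weight-≢ true s _ (1+n≢n {k}))) (if-eta _))) ⟩
  suc k * weight true (suc k) s (suc k) m
    + (if suc n * suc k ≤ᵇ m then weight true (suc k) s k (m ∸ suc n * suc k) else 0)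
    ∎
  where open ≡-Reasoning
... | inj₁ M<1+k with m≤n⇒m<n∨m≡n (≤-pred M<1+k)
...   | inj₂ refl = begin
  sumBelow (suc k) (λ v → weight∷ʳ true k s n (suc v) (suc k) m)
    ≡⟨ sumBelow-last k _ ⟩
  sumBelow k (λ v → weight∷ʳ true k s n (suc v) (suc k) m) + weight∷ʳ true k s n (suc k) (suc k) m
    ≡⟨ cong₂ _+_ (sumBelow-zero k (λ v v<k →
                    trans (weight∷ʳ-≤ s n (suc k) m v<k) (weight-≢ true s m k≢1+k)))
                 (trans (weight∷ʳ-record k s n (suc k) m) (weight-≡ (suc k) (s + suc n * suc k) m)) ⟩
  0 + indicator (s + suc n * suc k ≡ᵇ m)
    ≡⟨ cong₂ _+_ (sym (trans (cong (suc k *_) (weight-≢ true s m k≢1+k)) (*-zeroʳ (suc k))))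
                 (trans (indicator-+ s _ m)
                        (if-cong-then (suc n * suc k ≤ᵇ m) (sym (weight-≡ k s _)))) ⟩
  suc k * weight true k s (suc k) m
    + (if suc n * suc k ≤ᵇ m then weight true k s k (m ∸ suc n * suc k) else 0)
    ∎
  where
  open ≡-Reasoning
  k≢1+k : k ≢ suc k
  k≢1+k = <⇒≢ (n<1+n k)
...   | inj₁ M<k = trans (sumBelow-zero (suc k) vanish)
  (sym (cong₂ _+_ (trans (cong (suc k *_) (weight-≢ true s m (<⇒≢ M<1+k))) (*-zeroʳ (suc k)))
                  (trans (if-cong-then (suc n * suc k ≤ᵇ m) (weight-≢ true s (m ∸ suc n * suc k) (<⇒≢ M<k))) (if-eta _))))
  where
  vanish : ∀ v → v < suc k → weight∷ʳ true M s n (suc v) (suc k) m ≡ 0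
  vanish v _ with <-cmp v M
  ... | tri< v<M _ _ = trans (weight∷ʳ-≤ s n (suc k) m v<M) (weight-≢ true s m (<⇒≢ M<1+k))
  ... | tri≈ _ refl _ = trans (weight∷ʳ-record M s n (suc k) m) (weight-≢ true (s + suc n * suc M) m (<⇒≢ (s≤s M<k)))
  ... | tri> _ _ M<v = weight∷ʳ-jump s n (suc k) m (s≤s M<v)

record IsPartitionRecurrence (F : ℕ → Series) : Set where
  field
    empty   : ∀ m → F 0 0 m ≡ one 0 m
    noBlock : ∀ n m → F 0 (suc n) m ≡ 0
    noPoint : ∀ k m → F (suc k) 0 m ≡ 0
    step    : ∀ k n m → F (suc k) (suc n) m ≡
      suc k * F (suc k) n m + (if suc n * suc k ≤ᵇ m then F k n (m ∸ suc n * suc k) else 0)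

module _ {F G : ℕ → Series} (F-rec : IsPartitionRecurrence F) (G-rec : IsPartitionRecurrence G) where
  private
    module F = IsPartitionRecurrence F-rec
    module G = IsPartitionRecurrence G-rec

  recurrence-unique : ∀ k n m → F k n m ≡ G k n m
  recurrence-unique zero    zero    m = trans (F.empty m) (sym (G.empty m))
  recurrence-unique zero    (suc n) m = trans (F.noBlock n m) (sym (G.noBlock n m))
  recurrence-unique (suc k) zero    m = trans (F.noPoint k m) (sym (G.noPoint k m))
  recurrence-unique (suc k) (suc n) m = trans (F.step k n m)
    (trans (cong₂ _+_ (cong (suc k *_) (recurrence-unique (suc k) n m))
                      (if-cong-then (suc n * suc k ≤ᵇ m) (recurrence-unique k n (m ∸ suc n * suc k))))
           (sym (G.step k n m)))

Pk-suc-suc : ∀ k n m → Pk (suc k) (suc n) m ≡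
  suc k * Pk (suc k) n m + (if suc n * suc k ≤ᵇ m then Pk k n (m ∸ suc n * suc k) else 0)
Pk-suc-suc k n m = begin
  Pk K (suc n) m
    ≡⟨ Pk≡sumMap-χ K (suc n) m ⟩
  sumMap (χ K m) (words (suc n) K)
    ≡⟨ sumMap-words-∷ʳ n K (χ K m) ⟩
  sumMap (λ w → sumBelow K (λ v → χ K m (w ∷ʳ suc v))) (words n K)
    ≡⟨ sumMap-words-cong n K appendLast ⟩
  sumMap (λ w → K * χ K m w + (if c then χ k m′ w else 0)) (words n K)
    ≡⟨ sumMap-+ (words n K) _ _ ⟩
  sumMap (λ w → K * χ K m w) (words n K) + sumMap (λ w → if c then χ k m′ w else 0) (words n K)
    ≡⟨ cong₂ _+_ (sumMap-* (words n K) K (χ K m)) (sumMap-if (words n K) c (χ k m′)) ⟩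
  K * sumMap (χ K m) (words n K) + (if c then sumMap (χ k m′) (words n K) else 0)
    ≡⟨ cong₂ _+_ (cong (K *_) (sym (Pk≡sumMap-χ K n m)))
                 (if-cong-then c (trans (sumMap-words-shrink n k (χ k m′) χ-vanish)
                                        (sym (Pk≡sumMap-χ k n m′)))) ⟩
  K * Pk K n m + (if c then Pk k n m′ else 0)
    ∎
  where
  open ≡-Reasoning
  K : ℕ
  K = suc k
  c : Bool
  c = suc n * K ≤ᵇ m
  m′ : ℕ
  m′ = m ∸ suc n * K
  appendLast : ∀ w → length w ≡ n → maxW w ≤ K →
    sumBelow K (λ v → χ K m (w ∷ʳ suc v)) ≡ K * χ K m w + (if c then χ k m′ w else 0)
  appendLast w refl max-w = trans (sumBelow-cong K (λ v _ → χ-∷ʳ K m w v))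
    (sumBelow-weight∷ʳ (rgfFrom 0 w) (maxW w) (swrec w) (length w) k m max-w)
  χ-vanish : ∀ w → k < maxW w → χ k m′ w ≡ 0
  χ-vanish w k<max = weight-≢ (rgfFrom 0 w) (swrec w) m′ (λ max≡k → <⇒≢ k<max (sym max≡k))

Pk-recurrence : IsPartitionRecurrence Pk
Pk-recurrence = record
  { empty   = λ { zero → refl ; (suc m) → refl }
  ; noBlock = λ n m → trans (Pk≡sumMap-χ 0 (suc n) m)
                        (trans (sumMap-words-suc n 0 (χ 0 m)) (sumMap-zero (words n 0)))
  ; noPoint = λ k m → refl
  ; step    = Pk-suc-suc
  }

-- Power series in x and q

sumTo-cong : ∀ N {f g : ℕ → ℕ} → (∀ i → i ≤ N → f i ≡ g i) → sumTo N f ≡ sumTo N g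
sumTo-cong zero    eq = eq 0 z≤n
sumTo-cong (suc N) eq = cong₂ _+_ (sumTo-cong N (λ i i≤N → eq i (m≤n⇒m≤1+n i≤N))) (eq (suc N) ≤-refl)

sumTo-zero : ∀ N {f : ℕ → ℕ} → (∀ i → i ≤ N → f i ≡ 0) → sumTo N f ≡ 0
sumTo-zero zero    eq = eq 0 z≤n
sumTo-zero (suc N) eq = cong₂ _+_ (sumTo-zero N (λ i i≤N → eq i (m≤n⇒m≤1+n i≤N))) (eq (suc N) ≤-refl)

sumTo-+ : ∀ N (f g : ℕ → ℕ) → sumTo N (λ i → f i + g i) ≡ sumTo N f + sumTo N g
sumTo-+ zero    f g = refl
sumTo-+ (suc N) f g =
  trans (cong (_+ (f (suc N) + g (suc N))) (sumTo-+ N f g)) (+-interchange (sumTo N f) (sumTo N g) _ _)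

sumTo-* : ∀ N c (f : ℕ → ℕ) → sumTo N (λ i → c * f i) ≡ c * sumTo N f
sumTo-* zero    c f = refl
sumTo-* (suc N) c f = trans (cong (_+ c * f (suc N)) (sumTo-* N c f)) (sym (*-distribˡ-+ c _ _))

sumTo-if : ∀ N b (f : ℕ → ℕ) → sumTo N (λ i → if b then f i else 0) ≡ (if b then sumTo N f else 0)
sumTo-if N true  f = refl
sumTo-if N false f = sumTo-zero N (λ _ _ → refl)

sumTo-single : ∀ N a (f : ℕ → ℕ) → (∀ i → i ≤ N → i ≢ a → f i ≡ 0) → sumTo N f ≡ (if a ≤ᵇ N then f a else 0)
sumTo-single zero zero    f vanish = refl
sumTo-single zero (suc a) f vanish = vanish 0 z≤n (λ ())
sumTo-single (suc N) a f vanish =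
  trans (cong (_+ f (suc N)) (sumTo-single N a f (λ i i≤N → vanish i (m≤n⇒m≤1+n i≤N)))) last
  where
  last : (if a ≤ᵇ N then f a else 0) + f (suc N) ≡ (if a ≤ᵇ suc N then f a else 0)
  last with a ≤? N | a ≟ suc N
  ... | yes a≤N | _ rewrite ≤⇒≤ᵇ≡true a≤N | ≤⇒≤ᵇ≡true (m≤n⇒m≤1+n a≤N) =
    trans (cong (f a +_) (vanish (suc N) ≤-refl (λ 1+N≡a → <⇒≱ (s≤s a≤N) (≤-reflexive 1+N≡a)))) (+-identityʳ _)
  ... | no a≰N | yes refl rewrite ≰⇒≤ᵇ≡false a≰N | ≤⇒≤ᵇ≡true (≤-refl {suc N}) = refl
  ... | no a≰N | no a≢1+N
    rewrite ≰⇒≤ᵇ≡false a≰N | ≰⇒≤ᵇ≡false (λ a≤1+N → a≰N (≤-pred (≤∧≢⇒< a≤1+N a≢1+N))) =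
    vanish (suc N) ≤-refl (λ 1+N≡a → a≢1+N (sym 1+N≡a))

sumTo-trunc : ∀ T M (f : ℕ → ℕ) → T ≤ M → sumTo M (λ b → if b ≤ᵇ T then f b else 0) ≡ sumTo T f
sumTo-trunc T zero    f z≤n = refl
sumTo-trunc T (suc M) f T≤1+M with m≤n⇒m<n∨m≡n T≤1+M
... | inj₂ refl = sumTo-cong (suc M) (λ i i≤T → if-cong (≤⇒≤ᵇ≡true i≤T))
... | inj₁ T<1+M =
  trans (cong₂ _+_ (sumTo-trunc T M f (≤-pred T<1+M)) (if-cong (≰⇒≤ᵇ≡false (<⇒≱ T<1+M))))
        (+-identityʳ _)

shift : ℕ → (ℕ → ℕ) → ℕ → ℕ
shift d F m = if d ≤ᵇ m then F (m ∸ d) else 0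

conv : (ℕ → ℕ) → (ℕ → ℕ) → ℕ → ℕ
conv F G m = sumTo m (λ b → F b * G (m ∸ b))

shift-shift : ∀ a b (F : ℕ → ℕ) m → shift a (shift b F) m ≡ shift (a + b) F m
shift-shift a b F m rewrite ∸-+-assoc m a b with a ≤? m
... | no a≰m rewrite ≰⇒≤ᵇ≡false a≰m | ≰⇒≤ᵇ≡false {a + b} {m} (λ a+b≤m → a≰m (≤-trans (m≤m+n a b) a+b≤m)) = refl
... | yes a≤m rewrite ≤⇒≤ᵇ≡true a≤m with b ≤? m ∸ a
...   | yes b≤m∸a
  rewrite ≤⇒≤ᵇ≡true b≤m∸a | ≤⇒≤ᵇ≡true {a + b} {m} (subst (a + b ≤_) (m+[n∸m]≡n a≤m) (+-monoʳ-≤ a b≤m∸a)) = refl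
...   | no b≰m∸a
  rewrite ≰⇒≤ᵇ≡false b≰m∸a
        | ≰⇒≤ᵇ≡false {a + b} {m} (λ a+b≤m → b≰m∸a (subst (_≤ m ∸ a) (m+n∸m≡n a b) (∸-monoˡ-≤ a a+b≤m))) = refl

shift-≡ᵇ : ∀ a d M Y → shift d (λ M → if M ≡ᵇ a then Y else 0) M ≡ (if M ≡ᵇ a + d then Y else 0)
shift-≡ᵇ a d M Y with d ≤? M
... | no d≰M rewrite ≰⇒≤ᵇ≡false d≰M | ≢⇒≡ᵇ≡false {M} {a + d} (λ M≡a+d → d≰M (subst (d ≤_) (sym M≡a+d) (m≤n+m d a))) = refl
... | yes d≤M rewrite ≤⇒≤ᵇ≡true d≤M with M ∸ d ≟ a
...   | yes M∸d≡a rewrite ≡⇒≡ᵇ≡true M∸d≡a | ≡⇒≡ᵇ≡true {M} {a + d} (trans (sym (m∸n+n≡m d≤M)) (cong (_+ d) M∸d≡a)) = refl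
...   | no M∸d≢a rewrite ≢⇒≡ᵇ≡false M∸d≢a | ≢⇒≡ᵇ≡false {M} {a + d} (λ M≡a+d → M∸d≢a (trans (cong (_∸ d) M≡a+d) (m+n∸n≡m a d))) = refl

sumTo-shift : ∀ M d (F : ℕ → ℕ) → sumTo M (shift d F) ≡ shift d (λ M → sumTo M F) M
sumTo-shift zero    zero    F = refl
sumTo-shift zero    (suc d) F = refl
sumTo-shift (suc M) d F with d ≤? M | d ≟ suc M
... | yes d≤M | _ rewrite sumTo-shift M d F | ≤⇒≤ᵇ≡true d≤M | ≤⇒≤ᵇ≡true (m≤n⇒m≤1+n d≤M) | +-∸-assoc 1 d≤M = refl
... | no d≰M | yes refl rewrite sumTo-shift M (suc M) F | ≰⇒≤ᵇ≡false d≰M | ≤⇒≤ᵇ≡true (≤-refl {suc M}) | n∸n≡0 M = refl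
... | no d≰M | no d≢1+M
  rewrite sumTo-shift M d F | ≰⇒≤ᵇ≡false d≰M | ≰⇒≤ᵇ≡false (λ d≤1+M → d≰M (≤-pred (≤∧≢⇒< d≤1+M d≢1+M))) = refl

≤∸-swap : ∀ {m x y} → x ≤ m → y ≤ m ∸ x → x ≤ m ∸ y
≤∸-swap {m} {x} {y} x≤m y≤m∸x =
  m+n≤o⇒m≤o∸n x (subst (_≤ m) (+-comm y x) (m≤o∸n⇒m+n≤o y x≤m y≤m∸x))

conv-shiftˡ : ∀ d (F G : ℕ → ℕ) m → conv (shift d F) G m ≡ shift d (conv F G) m
conv-shiftˡ d F G m = trans (sumTo-cong m term) (sumTo-shift m d (λ x → F x * G ((m ∸ d) ∸ x)))
  where
  term : ∀ b → b ≤ m → shift d F b * G (m ∸ b) ≡ shift d (λ x → F x * G ((m ∸ d) ∸ x)) b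
  term b b≤m with d ≤? b
  ... | yes d≤b rewrite ≤⇒≤ᵇ≡true d≤b =
    cong (λ x → F (b ∸ d) * G x) (sym (trans (∸-+-assoc m d (b ∸ d)) (cong (m ∸_) (m+[n∸m]≡n d≤b))))
  ... | no d≰b rewrite ≰⇒≤ᵇ≡false d≰b = refl

conv-shiftʳ : ∀ d (F G : ℕ → ℕ) m → conv F (shift d G) m ≡ shift d (conv F G) m
conv-shiftʳ d F G m with d ≤? m
... | yes d≤m rewrite ≤⇒≤ᵇ≡true d≤m = trans (sumTo-cong m term) (sumTo-trunc (m ∸ d) m _ (m∸n≤m m d))
  where
  term : ∀ b → b ≤ m → F b * shift d G (m ∸ b) ≡ (if b ≤ᵇ m ∸ d then F b * G ((m ∸ d) ∸ b) else 0)
  term b b≤m with b ≤? m ∸ d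
  ... | yes b≤m∸d rewrite ≤⇒≤ᵇ≡true b≤m∸d | ≤⇒≤ᵇ≡true (≤∸-swap d≤m b≤m∸d) =
    cong (λ x → F b * G x) (trans (∸-+-assoc m b d) (trans (cong (m ∸_) (+-comm b d)) (sym (∸-+-assoc m d b))))
  ... | no b≰m∸d rewrite ≰⇒≤ᵇ≡false b≰m∸d
                        | ≰⇒≤ᵇ≡false {d} {m ∸ b} (λ d≤m∸b → b≰m∸d (≤∸-swap b≤m d≤m∸b)) = *-zeroʳ (F b)
... | no d≰m rewrite ≰⇒≤ᵇ≡false d≰m = sumTo-zero m (λ b _ →
  trans (cong (F b *_) (if-cong (≰⇒≤ᵇ≡false (λ d≤m∸b → d≰m (≤-trans d≤m∸b (m∸n≤m m b)))))) (*-zeroʳ (F b)))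

*-if : ∀ x b y → x * (if b then y else 0) ≡ (if b then x * y else 0)
*-if x b y = trans (if-float (x *_) b) (if-cong-else b (*-zeroʳ x))

shift-cong : ∀ d {F G : ℕ → ℕ} → (∀ m → F m ≡ G m) → ∀ m → shift d F m ≡ shift d G m
shift-cong d eq m = if-cong-then (d ≤ᵇ m) (eq (m ∸ d))

conv-*ʳ : ∀ (F G : ℕ → ℕ) c m → conv F (λ m′ → c * G m′) m ≡ c * conv F G m
conv-*ʳ F G c m = trans (sumTo-cong m (λ b _ → x*[c*y]≡c*[x*y] (F b) (G (m ∸ b)))) (sumTo-* m c _)
  where
  x*[c*y]≡c*[x*y] : ∀ x y → x * (c * y) ≡ c * (x * y)
  x*[c*y]≡c*[x*y] x y = trans (sym (*-assoc x c y)) (trans (cong (_* y) (*-comm x c)) (*-assoc c x y))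

conv-congʳ : ∀ (F : ℕ → ℕ) {G H : ℕ → ℕ} → (∀ b → G b ≡ H b) → ∀ m → conv F G m ≡ conv F H m
conv-congʳ F G≗H m = sumTo-cong m (λ b _ → cong (F b *_) (G≗H (m ∸ b)))

conv-zeroʳ : ∀ (F : ℕ → ℕ) m → conv F (λ _ → 0) m ≡ 0
conv-zeroʳ F m = sumTo-zero m (λ b _ → *-zeroʳ (F b))

conv-δ : ∀ (F : ℕ → ℕ) d m → conv F (λ m′ → if m′ ≡ᵇ d then 1 else 0) m ≡ shift d F m
conv-δ F d m =
  trans (sumTo-single m (m ∸ d) _ off) (trans (if-cong (≤⇒≤ᵇ≡true (m∸n≤m m d))) at-m∸d)
  where
  off : ∀ b → b ≤ m → b ≢ m ∸ d → F b * (if m ∸ b ≡ᵇ d then 1 else 0) ≡ 0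
  off b b≤m b≢m∸d rewrite ≢⇒≡ᵇ≡false {m ∸ b} {d} (λ m∸b≡d → b≢m∸d (trans (sym (m∸[m∸n]≡n b≤m)) (cong (m ∸_) m∸b≡d))) =
    *-zeroʳ (F b)
  at-m∸d : F (m ∸ d) * (if m ∸ (m ∸ d) ≡ᵇ d then 1 else 0) ≡ shift d F m
  at-m∸d with d ≤? m
  ... | yes d≤m rewrite m∸[m∸n]≡n d≤m | ≡⇒≡ᵇ≡true {d} refl | ≤⇒≤ᵇ≡true d≤m = *-identityʳ _
  ... | no d≰m rewrite m≤n⇒m∸n≡0 (<⇒≤ (≰⇒> d≰m)) | ≢⇒≡ᵇ≡false {m} {d} (λ m≡d → d≰m (≤-reflexive (sym m≡d)))
                     | ≰⇒≤ᵇ≡false d≰m = *-zeroʳ (F 0)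

infix 4 _≈_
_≈_ : Series → Series → Set
f ≈ g = ∀ n m → f n m ≡ g n m

≈-setoid : Setoid 0ℓ 0ℓ
≈-setoid = record
  { Carrier       = Series
  ; _≈_           = _≈_
  ; isEquivalence = record
    { refl  = λ n m → refl
    ; sym   = λ f≈g n m → sym (f≈g n m)
    ; trans = λ f≈g g≈h n m → trans (f≈g n m) (g≈h n m)
    }
  }

open Setoid ≈-setoid public using () renaming (refl to ≈-refl; sym to ≈-sym; trans to ≈-trans)

module ≈-Reasoning = SetoidReasoning ≈-setoid

⊛-cong : ∀ {f f′ g g′} → f ≈ f′ → g ≈ g′ → f ⊛ g ≈ f′ ⊛ g′
⊛-cong f≈f′ g≈g′ n m = sumTo-cong n (λ a _ → sumTo-cong m (λ b _ → cong₂ _*_ (f≈f′ a b) (g≈g′ (n ∸ a) (m ∸ b))))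

prodTo-cong : ∀ k {F G : ℕ → Series} → (∀ i → i ≤ k → F i ≈ G i) → prodTo k F ≈ prodTo k G
prodTo-cong zero    F≈G = ≈-refl
prodTo-cong (suc k) F≈G = ⊛-cong (prodTo-cong k (λ i i≤k → F≈G i (m≤n⇒m≤1+n i≤k))) (F≈G (suc k) ≤-refl)

Sh : ℕ → Series → Series
Sh d f n = shift d (f n)

-- f(x q^c, q)
U : ℕ → Series → Series
U c f n = shift (n * c) (f n)

Sh-cong : ∀ d {f g} → f ≈ g → Sh d f ≈ Sh d g
Sh-cong d f≈g n = shift-cong d (f≈g n)

Sh-index : ∀ {d d′} f → d ≡ d′ → Sh d f ≈ Sh d′ f
Sh-index f refl = ≈-refl

U-cong : ∀ c {f g} → f ≈ g → U c f ≈ U c g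
U-cong c f≈g n = shift-cong (n * c) (f≈g n)

Sh-Sh : ∀ a b f → Sh a (Sh b f) ≈ Sh (a + b) f
Sh-Sh a b f n = shift-shift a b (f n)

Sh-⊛ˡ : ∀ d f g → Sh d f ⊛ g ≈ Sh d (f ⊛ g)
Sh-⊛ˡ d f g n m = trans (sumTo-cong n (λ a _ → conv-shiftˡ d (f a) (g (n ∸ a)) m)) (sumTo-if n (d ≤ᵇ m) _)

Sh-⊛ʳ : ∀ d f g → f ⊛ Sh d g ≈ Sh d (f ⊛ g)
Sh-⊛ʳ d f g n m = trans (sumTo-cong n (λ a _ → conv-shiftʳ d (f a) (g (n ∸ a)) m)) (sumTo-if n (d ≤ᵇ m) _)

U-Sh : ∀ c d f → U c (Sh d f) ≈ Sh d (U c f)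
U-Sh c d f n m = trans (shift-shift (n * c) d (f n) m)
  (trans (cong (λ e → shift e (f n) m) (+-comm (n * c) d)) (sym (shift-shift d (n * c) (f n) m)))

U-one : ∀ c → U c one ≈ one
U-one c zero    m = refl
U-one c (suc n) m = if-eta _

U-⊛ : ∀ c f g → U c (f ⊛ g) ≈ U c f ⊛ U c g
U-⊛ c f g n m = sym (trans (sumTo-cong n term) (sumTo-if n (n * c ≤ᵇ m) _))
  where
  term : ∀ a → a ≤ n → conv (U c f a) (U c g (n ∸ a)) m ≡ shift (n * c) (conv (f a) (g (n ∸ a))) m
  term a a≤n = begin
    conv (shift (a * c) (f a)) (shift ((n ∸ a) * c) (g (n ∸ a))) m
      ≡⟨ conv-shiftˡ (a * c) (f a) (shift ((n ∸ a) * c) (g (n ∸ a))) m ⟩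
    shift (a * c) (conv (f a) (shift ((n ∸ a) * c) (g (n ∸ a)))) m
      ≡⟨ shift-cong (a * c) (conv-shiftʳ ((n ∸ a) * c) (f a) (g (n ∸ a))) m ⟩
    shift (a * c) (shift ((n ∸ a) * c) (conv (f a) (g (n ∸ a)))) m
      ≡⟨ shift-shift (a * c) ((n ∸ a) * c) (conv (f a) (g (n ∸ a))) m ⟩
    shift (a * c + (n ∸ a) * c) (conv (f a) (g (n ∸ a))) m
      ≡⟨ cong (λ e → shift e (conv (f a) (g (n ∸ a))) m)
              (trans (sym (*-distribʳ-+ c a (n ∸ a))) (cong (_* c) (m+[n∸m]≡n a≤n))) ⟩
    shift (n * c) (conv (f a) (g (n ∸ a))) m
      ∎
    where open ≡-Reasoning

Sh-prodTo : ∀ k (E : ℕ → ℕ) (H : ℕ → Series) →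
  prodTo k (λ i → Sh (E i) (H i)) ≈ Sh (sumBelow k (E ∘ suc)) (prodTo k H)
Sh-prodTo zero    E H = ≈-refl
Sh-prodTo (suc k) E H = begin
  prodTo k (λ i → Sh (E i) (H i)) ⊛ Sh (E (suc k)) (H (suc k))
    ≈⟨ ⊛-cong {g = Sh (E (suc k)) (H (suc k))} (Sh-prodTo k E H) ≈-refl ⟩
  Sh (sumBelow k (E ∘ suc)) (prodTo k H) ⊛ Sh (E (suc k)) (H (suc k))
    ≈⟨ Sh-⊛ˡ (sumBelow k (E ∘ suc)) (prodTo k H) (Sh (E (suc k)) (H (suc k))) ⟩
  Sh (sumBelow k (E ∘ suc)) (prodTo k H ⊛ Sh (E (suc k)) (H (suc k)))
    ≈⟨ Sh-cong (sumBelow k (E ∘ suc)) (Sh-⊛ʳ (E (suc k)) (prodTo k H) (H (suc k))) ⟩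
  Sh (sumBelow k (E ∘ suc)) (Sh (E (suc k)) (prodTo k H ⊛ H (suc k)))
    ≈⟨ Sh-Sh (sumBelow k (E ∘ suc)) (E (suc k)) (prodTo (suc k) H) ⟩
  Sh (sumBelow k (E ∘ suc) + E (suc k)) (prodTo (suc k) H)
    ≈⟨ Sh-index (prodTo (suc k) H) (sym (sumBelow-last k (E ∘ suc))) ⟩
  Sh (sumBelow (suc k) (E ∘ suc)) (prodTo (suc k) H)
    ∎
  where open ≈-Reasoning

U-prodTo : ∀ k c (F : ℕ → Series) → U c (prodTo k F) ≈ prodTo k (U c ∘ F)
U-prodTo zero    c F = U-one c
U-prodTo (suc k) c F = ≈-trans (U-⊛ c (prodTo k F) (F (suc k))) (⊛-cong {g = U c (F (suc k))} (U-prodTo k c F) ≈-refl)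

-- x / (1 − c x q^s)
xGeom : ℕ → ℕ → Series
xGeom c s zero    m = 0
xGeom c s (suc n) m = if m ≡ᵇ n * s then c ^ n else 0

U-xGeom : ∀ d c s → U d (xGeom c s) ≈ Sh d (xGeom c (s + d))
U-xGeom d c s zero    m = sym (if-eta _)
U-xGeom d c s (suc n) m = begin
  shift (suc n * d) (λ m′ → if m′ ≡ᵇ n * s then c ^ n else 0) m
    ≡⟨ shift-≡ᵇ (n * s) (d + n * d) m (c ^ n) ⟩
  (if m ≡ᵇ n * s + (d + n * d) then c ^ n else 0)
    ≡⟨ if-cong (cong (m ≡ᵇ_) exponent) ⟩
  (if m ≡ᵇ n * (s + d) + d then c ^ n else 0)
    ≡⟨ sym (shift-≡ᵇ (n * (s + d)) d m (c ^ n)) ⟩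
  shift d (λ m′ → if m′ ≡ᵇ n * (s + d) then c ^ n else 0) m
    ∎
  where
  open ≡-Reasoning
  exponent : n * s + (d + n * d) ≡ n * (s + d) + d
  exponent = trans (cong (n * s +_) (+-comm d (n * d)))
    (trans (sym (+-assoc (n * s) (n * d) d)) (cong (_+ d) (sym (*-distribˡ-+ n s d))))

mono-⊛ : ∀ c a b g n m →
  (mono c a b ⊛ g) n m ≡ (if a ≤ᵇ n then (if b ≤ᵇ m then c * g (n ∸ a) (m ∸ b) else 0) else 0)
mono-⊛ c a b g n m = begin
  sumTo n (λ a′ → sumTo m (λ b′ → mono c a b a′ b′ * g (n ∸ a′) (m ∸ b′)))
    ≡⟨ sumTo-single n a _ (λ a′ _ a′≢a → sumTo-zero m (λ b′ _ →
         cong (_* g (n ∸ a′) (m ∸ b′)) (if-cong (cong (_∧ (b′ ≡ᵇ b)) (≢⇒≡ᵇ≡false a′≢a))))) ⟩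
  (if a ≤ᵇ n then sumTo m (λ b′ → mono c a b a b′ * g (n ∸ a) (m ∸ b′)) else 0)
    ≡⟨ if-cong-then (a ≤ᵇ n) (sumTo-single m b _ (λ b′ _ b′≢b →
         cong (_* g (n ∸ a) (m ∸ b′)) (if-cong (cong₂ _∧_ (≡⇒≡ᵇ≡true {a} refl) (≢⇒≡ᵇ≡false b′≢b))))) ⟩
  (if a ≤ᵇ n then (if b ≤ᵇ m then mono c a b a b * g (n ∸ a) (m ∸ b) else 0) else 0)
    ≡⟨ if-cong-then (a ≤ᵇ n) (if-cong-then (b ≤ᵇ m) (cong (_* g (n ∸ a) (m ∸ b))
         (if-cong (cong₂ _∧_ (≡⇒≡ᵇ≡true {a} refl) (≡⇒≡ᵇ≡true {b} refl))))) ⟩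
  (if a ≤ᵇ n then (if b ≤ᵇ m then c * g (n ∸ a) (m ∸ b) else 0) else 0)
    ∎
  where open ≡-Reasoning

pow-mono : ∀ c s a → pow (mono c 1 s) a ≈ mono (c ^ a) a (a * s)
pow-mono c s zero    zero    zero    = refl
pow-mono c s zero    zero    (suc m) = refl
pow-mono c s zero    (suc n) m       = refl
pow-mono c s (suc a) n       m       =
  trans (⊛-cong {mono c 1 s} ≈-refl (pow-mono c s a) n m)
        (trans (mono-⊛ c 1 s (mono (c ^ a) a (a * s)) n m) (peel n))
  where
  peel : ∀ n → (if 1 ≤ᵇ n then (if s ≤ᵇ m then c * mono (c ^ a) a (a * s) (n ∸ 1) (m ∸ s) else 0) else 0)
             ≡ mono (c ^ suc a) (suc a) (suc a * s) n m
  peel zero = refl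
  peel (suc n) with n ≟ a
  ... | no n≢a rewrite ≢⇒≡ᵇ≡false n≢a | *-zeroʳ c = if-eta _
  ... | yes refl rewrite ≡⇒≡ᵇ≡true {n} refl =
    trans (if-cong-then (s ≤ᵇ m) (*-if c (m ∸ s ≡ᵇ n * s) (c ^ n)))
      (trans (shift-≡ᵇ (n * s) s m (c * c ^ n)) (if-cong (cong (m ≡ᵇ_) (+-comm (n * s) s))))

geom-mono : ∀ c s n m → geom (mono c 1 s) n m ≡ (if m ≡ᵇ n * s then c ^ n else 0)
geom-mono c s n m =
  trans (sumTo-cong n (λ a _ → pow-mono c s a n m))
    (trans (sumTo-single n n _ (λ a _ a≢n → if-cong (cong (_∧ (m ≡ᵇ a * s)) (≢⇒≡ᵇ≡false (a≢n ∘ sym)))))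
      (trans (if-cong (≤⇒≤ᵇ≡true (≤-refl {n}))) (if-cong (cong (_∧ (m ≡ᵇ n * s)) (≡⇒≡ᵇ≡true {n} refl)))))

x-⊛-geom : ∀ e c s → mono 1 1 e ⊛ geom (mono c 1 s) ≈ Sh e (xGeom c s)
x-⊛-geom e c s zero    m = trans (mono-⊛ 1 1 e (geom (mono c 1 s)) 0 m) (sym (if-eta _))
x-⊛-geom e c s (suc n) m = trans (mono-⊛ 1 1 e (geom (mono c 1 s)) (suc n) m)
  (if-cong-then (e ≤ᵇ m) (trans (+-identityʳ _) (geom-mono c s n (m ∸ e))))

-- The product side

numeratorExponent : ℕ → ℕ → ℕ
numeratorExponent k i = i + (suc k ∸ i) * (k ∸ i)

factor≈Sh-xGeom : ∀ k i → factor k i ≈ Sh (numeratorExponent k i) (xGeom i (sumFrom i k))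
factor≈Sh-xGeom k i = x-⊛-geom (numeratorExponent k i) i (sumFrom i k)

-- x q^d / (1 − c x)
shiftedGeom : ℕ → ℕ → Series
shiftedGeom c d zero    m = 0
shiftedGeom c d (suc n) m = if m ≡ᵇ d then c ^ n else 0

factor-last : ∀ k → factor k k ≈ shiftedGeom k k
factor-last k n m =
  trans (factor≈Sh-xGeom k k n m) (trans (cong₂ (λ e s → Sh e (xGeom k s) n m) exponent sumFrom-k-k) (closed n))
  where
  exponent : numeratorExponent k k ≡ k
  exponent rewrite n∸n≡0 k | *-zeroʳ (suc k ∸ k) = +-identityʳ k
  sumFrom-k-k : sumFrom k k ≡ 0
  sumFrom-k-k rewrite n∸n≡0 k = refl
  closed : ∀ n → Sh k (xGeom k 0) n m ≡ shiftedGeom k k n m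
  closed zero    = if-eta _
  closed (suc n) rewrite *-zeroʳ n = shift-≡ᵇ 0 k m (k ^ n)

-- (1 − c x) (A ⊛ G) = x q^d A  for  G = x q^d / (1 − c x)
⊛-shiftedGeom-suc : ∀ (A : Series) c d n m →
  (A ⊛ shiftedGeom c d) (suc n) m ≡ c * (A ⊛ shiftedGeom c d) n m + Sh d A n m
⊛-shiftedGeom-suc A c d n m = begin
  sumTo n (λ a → conv (A a) (G (suc n ∸ a)) m) + conv (A (suc n)) (G (suc n ∸ suc n)) m
    ≡⟨ cong (sumTo n (λ a → conv (A a) (G (suc n ∸ a)) m) +_)
            (trans (cong (λ j → conv (A (suc n)) (G j) m) (n∸n≡0 n)) (conv-zeroʳ (A (suc n)) m)) ⟩
  sumTo n (λ a → conv (A a) (G (suc n ∸ a)) m) + 0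
    ≡⟨ +-identityʳ _ ⟩
  sumTo n (λ a → conv (A a) (G (suc n ∸ a)) m)
    ≡⟨ sumTo-cong n term ⟩
  sumTo n (λ a → c * conv (A a) (G (n ∸ a)) m + (if a ≡ᵇ n then Sh d A n m else 0))
    ≡⟨ sumTo-+ n _ _ ⟩
  sumTo n (λ a → c * conv (A a) (G (n ∸ a)) m) + sumTo n (λ a → if a ≡ᵇ n then Sh d A n m else 0)
    ≡⟨ cong₂ _+_ (sumTo-* n c _)
         (trans (sumTo-single n n _ (λ a _ a≢n → if-cong (≢⇒≡ᵇ≡false a≢n)))
           (trans (if-cong (≤⇒≤ᵇ≡true (≤-refl {n}))) (if-cong (≡⇒≡ᵇ≡true {n} refl)))) ⟩
  c * (A ⊛ G) n m + Sh d A n m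
    ∎
  where
  open ≡-Reasoning
  G : Series
  G = shiftedGeom c d
  term : ∀ a → a ≤ n → conv (A a) (G (suc n ∸ a)) m ≡ c * conv (A a) (G (n ∸ a)) m + (if a ≡ᵇ n then Sh d A n m else 0)
  term a a≤n with m≤n⇒m<n∨m≡n a≤n
  ... | inj₂ refl = begin
    conv (A a) (G (suc a ∸ a)) m
      ≡⟨ cong (λ j → conv (A a) (G j) m) (m+n∸n≡m 1 a) ⟩
    conv (A a) (G 1) m
      ≡⟨ conv-δ (A a) d m ⟩
    Sh d A a m
      ≡⟨ sym (cong₂ _+_ (trans (cong (λ j → c * conv (A a) (G j) m) (n∸n≡0 a))
                               (trans (cong (c *_) (conv-zeroʳ (A a) m)) (*-zeroʳ c)))
                        (if-cong (≡⇒≡ᵇ≡true {a} refl))) ⟩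
    c * conv (A a) (G (a ∸ a)) m + (if a ≡ᵇ a then Sh d A a m else 0)
      ∎
  ... | inj₁ a<n = begin
    conv (A a) (G (suc n ∸ a)) m
      ≡⟨ cong (λ i → conv (A a) (G i) m) (trans (+-∸-assoc 1 a≤n) (cong suc n∸a≡1+j)) ⟩
    conv (A a) (G (suc (suc j))) m
      ≡⟨ conv-congʳ (A a) (λ m′ → sym (*-if c (m′ ≡ᵇ d) (c ^ j))) m ⟩
    conv (A a) (λ m′ → c * G (suc j) m′) m
      ≡⟨ conv-*ʳ (A a) (G (suc j)) c m ⟩
    c * conv (A a) (G (suc j)) m
      ≡⟨ cong (λ i → c * conv (A a) (G i) m) (sym n∸a≡1+j) ⟩
    c * conv (A a) (G (n ∸ a)) m
      ≡⟨ sym (trans (cong (c * conv (A a) (G (n ∸ a)) m +_) (if-cong (≢⇒≡ᵇ≡false (<⇒≢ a<n)))) (+-identityʳ _)) ⟩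
    c * conv (A a) (G (n ∸ a)) m + (if a ≡ᵇ n then Sh d A n m else 0)
      ∎
    where
    j : ℕ
    j = n ∸ suc a
    n∸a≡1+j : n ∸ a ≡ suc j
    n∸a≡1+j = +-∸-assoc 1 a<n

sum-map-applyUpTo : ∀ (f g : ℕ → ℕ) n → sum (map f (applyUpTo g n)) ≡ sumBelow n (f ∘ g)
sum-map-applyUpTo f g zero    = refl
sum-map-applyUpTo f g (suc n) = cong (f (g 0) +_) (sum-map-applyUpTo f (g ∘ suc) n)

sumFrom-suc : ∀ i k → i ≤ k → sumFrom i (suc k) ≡ sumFrom i k + suc k
sumFrom-suc i k i≤k = begin
  sum (map (suc i +_) (applyUpTo id (suc k ∸ i)))
    ≡⟨ sum-map-applyUpTo (suc i +_) id (suc k ∸ i) ⟩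
  sumBelow (suc k ∸ i) (suc i +_)
    ≡⟨ cong (λ l → sumBelow l (suc i +_)) (+-∸-assoc 1 i≤k) ⟩
  sumBelow (suc (k ∸ i)) (suc i +_)
    ≡⟨ sumBelow-last (k ∸ i) (suc i +_) ⟩
  sumBelow (k ∸ i) (suc i +_) + suc (i + (k ∸ i))
    ≡⟨ cong₂ _+_ (sym (sum-map-applyUpTo (suc i +_) id (k ∸ i))) (cong suc (m+[n∸m]≡n i≤k)) ⟩
  sumFrom i k + suc k
    ∎
  where open ≡-Reasoning

numeratorExponent-suc : ∀ k t → t < k →
  numeratorExponent (suc k) (suc t) ≡ numeratorExponent k (suc t) + (k ∸ t + (k ∸ t))
numeratorExponent-suc k t t<k rewrite +-∸-assoc 1 (<⇒≤ t<k) | +-∸-assoc 1 t<k = arith t (k ∸ suc t)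
  where
  open +-*-Solver
  arith : ∀ t j → suc t + suc (suc j) * suc j ≡ suc t + suc j * j + (suc j + suc j)
  arith = solve 2 (λ t j → con 1 :+ t :+ (con 2 :+ j) :* (con 1 :+ j)
                        := con 1 :+ t :+ (con 1 :+ j) :* j :+ ((con 1 :+ j) :+ (con 1 :+ j))) refl

twice-triangle : ∀ k → sumBelow k (k ∸_) + sumBelow k (k ∸_) ≡ k * suc k
twice-triangle zero    = refl
twice-triangle (suc k) =
  trans (+-interchange (suc k) (sumBelow k (k ∸_)) (suc k) (sumBelow k (k ∸_)))
        (trans (cong (suc k + suc k +_) (twice-triangle k)) (arith k))
  where
  open +-*-Solver
  arith : ∀ k → suc k + suc k + k * suc k ≡ suc k * suc (suc k)
  arith = solve 1 (λ k → (con 1 :+ k) :+ (con 1 :+ k) :+ k :* (con 1 :+ k) := (con 1 :+ k) :* (con 2 :+ k)) refl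

sumBelow-numeratorExponent-suc : ∀ k →
  sumBelow k (numeratorExponent (suc k) ∘ suc) ≡ sumBelow k (numeratorExponent k ∘ suc) + sumBelow k (λ _ → suc k)
sumBelow-numeratorExponent-suc k = begin
  sumBelow k (numeratorExponent (suc k) ∘ suc)
    ≡⟨ sumBelow-cong k (numeratorExponent-suc k) ⟩
  sumBelow k (λ t → numeratorExponent k (suc t) + (k ∸ t + (k ∸ t)))
    ≡⟨ sumBelow-+ k (numeratorExponent k ∘ suc) _ ⟩
  sumBelow k (numeratorExponent k ∘ suc) + sumBelow k (λ t → k ∸ t + (k ∸ t))
    ≡⟨ cong (sumBelow k (numeratorExponent k ∘ suc) +_)
         (trans (sumBelow-+ k (k ∸_) (k ∸_)) (trans (twice-triangle k) (sym (sumBelow-const k (suc k))))) ⟩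
  sumBelow k (numeratorExponent k ∘ suc) + sumBelow k (λ _ → suc k)
    ∎
  where open ≡-Reasoning

numerators : ℕ → ℕ
numerators k = sumBelow k (numeratorExponent k ∘ suc)

denominators : ℕ → Series
denominators k = prodTo k (λ i → xGeom i (sumFrom i k))

RHS≈Sh-denominators : ∀ k → RHS k ≈ Sh (numerators k) (denominators k)
RHS≈Sh-denominators k = ≈-trans (prodTo-cong k (λ i _ → factor≈Sh-xGeom k i)) (Sh-prodTo k (numeratorExponent k) _)

-- Only the total q-exponent of the first k factors of P_{k+1} matches that of P_k(x q^{k+1}), not
-- the exponent of each factor.
factors≈U-RHS : ∀ k → prodTo k (factor (suc k)) ≈ U (suc k) (RHS k)
factors≈U-RHS k = begin
  prodTo k (factor K)
    ≈⟨ prodTo-cong k (λ i _ → factor≈Sh-xGeom K i) ⟩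
  prodTo k (λ i → Sh (numeratorExponent K i) (xGeom i (sumFrom i K)))
    ≈⟨ Sh-prodTo k (numeratorExponent K) _ ⟩
  Sh (sumBelow k (numeratorExponent K ∘ suc)) (prodTo k (λ i → xGeom i (sumFrom i K)))
    ≈⟨ Sh-index (prodTo k (λ i → xGeom i (sumFrom i K))) (sumBelow-numeratorExponent-suc k) ⟩
  Sh (numerators k + sumBelow k (λ _ → K)) (prodTo k (λ i → xGeom i (sumFrom i K)))
    ≈⟨ ≈-sym (Sh-Sh (numerators k) (sumBelow k (λ _ → K)) (prodTo k (λ i → xGeom i (sumFrom i K)))) ⟩
  Sh (numerators k) (Sh (sumBelow k (λ _ → K)) (prodTo k (λ i → xGeom i (sumFrom i K))))
    ≈⟨ Sh-cong (numerators k) (≈-sym (Sh-prodTo k (λ _ → K) _)) ⟩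
  Sh (numerators k) (prodTo k (λ i → Sh K (xGeom i (sumFrom i K))))
    ≈⟨ Sh-cong (numerators k) (prodTo-cong k (λ i i≤k → ≈-sym (U-xGeom′ i i≤k))) ⟩
  Sh (numerators k) (prodTo k (λ i → U K (xGeom i (sumFrom i k))))
    ≈⟨ Sh-cong (numerators k) (≈-sym (U-prodTo k K _)) ⟩
  Sh (numerators k) (U K (denominators k))
    ≈⟨ ≈-sym (U-Sh K (numerators k) (denominators k)) ⟩
  U K (Sh (numerators k) (denominators k))
    ≈⟨ U-cong K (≈-sym (RHS≈Sh-denominators k)) ⟩
  U K (RHS k)
    ∎
  where
  open ≈-Reasoning
  K : ℕ
  K = suc k
  U-xGeom′ : ∀ i → i ≤ k → U K (xGeom i (sumFrom i k)) ≈ Sh K (xGeom i (sumFrom i K))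
  U-xGeom′ i i≤k n m = trans (U-xGeom K i (sumFrom i k) n m)
    (cong (λ s → Sh K (xGeom i s) n m) (sym (sumFrom-suc i k i≤k)))

RHS-suc≈ : ∀ k → RHS (suc k) ≈ prodTo k (factor (suc k)) ⊛ shiftedGeom (suc k) (suc k)
RHS-suc≈ k = ⊛-cong {prodTo k (factor (suc k))} ≈-refl (factor-last (suc k))

RHS-suc-suc : ∀ k n m → RHS (suc k) (suc n) m ≡
  suc k * RHS (suc k) n m + (if suc n * suc k ≤ᵇ m then RHS k n (m ∸ suc n * suc k) else 0)
RHS-suc-suc k n m = begin
  RHS K (suc n) m
    ≡⟨ RHS-suc≈ k (suc n) m ⟩
  (F ⊛ shiftedGeom K K) (suc n) m
    ≡⟨ ⊛-shiftedGeom-suc F K K n m ⟩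
  K * (F ⊛ shiftedGeom K K) n m + Sh K F n m
    ≡⟨ cong₂ _+_ (cong (K *_) (sym (RHS-suc≈ k n m))) (Sh-cong K (factors≈U-RHS k) n m) ⟩
  K * RHS K n m + Sh K (U K (RHS k)) n m
    ≡⟨ cong (K * RHS K n m +_) (shift-shift K (n * K) (RHS k n) m) ⟩
  K * RHS K n m + (if suc n * K ≤ᵇ m then RHS k n (m ∸ suc n * K) else 0)
    ∎
  where
  open ≡-Reasoning
  K : ℕ
  K = suc k
  F : Series
  F = prodTo k (factor K)

RHS-recurrence : IsPartitionRecurrence RHS
RHS-recurrence = record
  { empty   = λ m → refl
  ; noBlock = λ n m → refl
  ; noPoint = λ k m → trans (RHS-suc≈ k 0 m) (conv-zeroʳ (prodTo k (factor (suc k)) 0) m)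
  ; step    = RHS-suc-suc
  }

-- The identity holds for k = 0 as well.
theorem1 : (k : ℕ) → 1 ≤ k → (n m : ℕ) → Pk k n m ≡ RHS k n m
theorem1 k _ = recurrence-unique Pk-recurrence RHS-recurrence k
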